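{- Let $G$ be an $r$-regular simple graph on $n$ vertices, where $n$ and $r$ are even, and suppose that either ($n \geq 64$ and $r < 3n/4$) or ($n < 64$ and $r < n-16$). If $G$ contains a complete bipartite subgraph $H$ with $V(H) = V(G)$, then $G$ can be extended to an $(r+1)$-regular graph on $n$ vertices, i.e., there is a set $F$ of edges of the complement $G^c$ such that $(V(G), E(G)\cup F)$ is $(r+1)$-regular.
   Context: All graphs are finite and simple. "Extending $G(n,r)$ to $G(n,r+1)$" means adding edges (not already present) to an $r$-regular graph on $n$ vertices, keeping the same vertex set, so that the resulting graph is $(r+1)$-regular. A complete bipartite subgraph $H$ with $V(H)=V(G)$ means $V(G)$ is partitioned into two nonempty parts $A,B$ such that every vertex of $A$ is adjacent in $G$ to every vertex of $B$. -}

module Defs where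

open import Data.Nat using (ℕ; zero; suc; _+_)
open import Data.Bool using (Bool; true; false)
open import Data.Fin using (Fin)
open import Data.Product using (∃; _×_)
open import Relation.Binary.PropositionalEquality using (_≡_)

countTrue : ∀ {n} → (Fin n → Bool) → ℕ
countTrue {zero}  f = 0
countTrue {suc n} f with f Fin.zero
... | true  = suc (countTrue {n} (λ i → f (Fin.suc i)))
... | false = countTrue {n} (λ i → f (Fin.suc i))

record Graph (n : ℕ) : Set where
  field
    adj   : Fin n → Fin n → Bool
    sym   : ∀ u v → adj u v ≡ adj v u
    irrefl : ∀ v → adj v v ≡ false
open Graph public

degree : ∀ {n} → Graph n → Fin n → ℕ
degree G v = countTrue (adj G v)

Regular : ∀ {n} → ℕ → Graph n → Set
Regular r G = ∀ v → degree G v ≡ r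

SubgraphOf : ∀ {n} → Graph n → Graph n → Set
SubgraphOf G G' = ∀ u v → adj G u v ≡ true → adj G' u v ≡ true

-- G contains a complete bipartite subgraph H with V(H) = V(G):
-- a partition of V(G) into two nonempty parts A (side true) and B (side false)
-- with every vertex of A adjacent to every vertex of B
HasSpanningCompleteBipartite : ∀ {n} → Graph n → Set
HasSpanningCompleteBipartite {n} G =
  ∃ λ (side : Fin n → Bool) →
    (∃ λ a → side a ≡ true) × (∃ λ b → side b ≡ false) ×
    (∀ u v → side u ≡ true → side v ≡ false → adj G u v ≡ true)

module Submission where

-- Let A, B be the sides of the spanning complete bipartite subgraph. A vertex of A is adjacent
-- to all of B, so its non-neighbours other than itself lie in A: the complement of G restricted
-- to A is d-regular with d = n - 1 - r, which is odd, and |A| ≤ r since a vertex of B sees all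
-- of A; the hypothesis on n and r gives r ≤ 3d + 6. The same holds for B. A d-regular graph
-- with d odd on at most 3d + 6 vertices has a perfect matching, and adding the perfect
-- matchings of both sides to G raises every degree by one.
--
-- The matching result is a Tutte-type count. Delete, one at a time, vertices covered by every
-- maximum matching (a set S); on what remains every vertex is avoided by some maximum
-- matching, and then (Gallai) the exposed vertices of a maximum matching lie in distinct
-- components, each of odd order. A maximum matching that is not perfect leaves at least two
-- vertices exposed, so there are at least |S| + 2 of these components. An odd component sends
-- at least one edge to S by parity, at least d edges if it has at most d vertices, and
-- otherwise has at least d + 2 vertices; since S receives at most d|S| edges, this
-- contradicts |A| ≤ 3d + 6.

open import Data.Bool using (Bool; true; false; _∧_; _∨_; not)
import Data.Bool as Bool
open import Data.Bool.Properties using (¬-not; ∧-identityʳ; ∧-zeroʳ; ∧-assoc; ∨-identityʳ; ∨-zeroʳ)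
open import Data.Empty using (⊥; ⊥-elim)
open import Data.Fin using (Fin) renaming (zero to fz; suc to fs)
import Data.Fin as Fin
open import Data.Fin.Properties using (any?)
open import Data.Maybe using (Maybe; just; nothing; is-just)
open import Data.Maybe.Properties using (just-injective; ≡-dec)
open import Data.Nat using (ℕ; zero; suc; _+_; _*_; _∸_; _≤_; _<_; _≥_; _≮_; z≤n; s≤s)
open import Data.Nat.Divisibility using (_∣_; divides; ∣m+n∣m⇒∣n; ∣m∣n⇒∣m+n)
open import Data.Nat.Induction using (<-wellFounded)
open import Data.Nat.Primality using (euclidsLemma; prime[2])
open import Data.Nat.Properties
open import Algebra.Properties.Semiring.Sum +-*-semiring
  using (sum; sum-cong-≗; ∑-distrib-+; ∑-comm; *-distribˡ-sum; *-distribʳ-sum; sum-replicate-zero)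
open import Data.Nat.Tactic.RingSolver using (solve-∀)
open import Data.Product using (Σ; ∃; _×_; _,_; proj₁; proj₂)
open import Data.Sum using (_⊎_; inj₁; inj₂)
open import Data.Vec.Functional using (updateAt)
open import Data.Vec.Functional.Properties using (updateAt-updates; updateAt-minimal)
open import Function using (_∘_; const)
open import Induction.WellFounded using (module All)
import Relation.Binary.Construct.On as On
open import Relation.Binary.PropositionalEquality
open import Relation.Nullary using (¬_; Dec; yes; no; does; contradiction)
open import Relation.Nullary.Decidable using (dec-true; dec-false; ¬¬-excluded-middle)
open import Relation.Nullary.Negation using (DoubleNegation)

-- Defs re-exports the field Graph.sym, which would clash with sym on ≡.
open import Defs hiding (sym)

toℕ : Bool → ℕ
toℕ true = 1
toℕ false = 0

∧-true : ∀ {a b} → a ≡ true → b ≡ true → a ∧ b ≡ true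
∧-true refl refl = refl

∧-trueˡ : ∀ {a b} → a ∧ b ≡ true → a ≡ true
∧-trueˡ {true} _ = refl

∧-trueʳ : ∀ {a b} → a ∧ b ≡ true → b ≡ true
∧-trueʳ {true} e = e

not-false : ∀ {b} → b ≡ false → not b ≡ true
not-false refl = refl

not-true : ∀ {b} → not b ≡ true → b ≡ false
not-true {false} _ = refl

does-true⇒ : ∀ {A : Set} (a? : Dec A) → does a? ≡ true → A
does-true⇒ (yes a) _ = a

does-false⇒ : ∀ {A : Set} (a? : Dec A) → does a? ≡ false → ¬ A
does-false⇒ (no ¬a) _ = ¬a

_≡ᵇ_ : ∀ {n} → Fin n → Fin n → Bool
i ≡ᵇ j = does (i Fin.≟ j)

≡ᵇ-refl : ∀ {n} (i : Fin n) → (i ≡ᵇ i) ≡ true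
≡ᵇ-refl i = dec-true (i Fin.≟ i) refl

≢⇒≡ᵇ-false : ∀ {n} {i j : Fin n} → i ≢ j → (i ≡ᵇ j) ≡ false
≢⇒≡ᵇ-false {i = i} {j} = dec-false (i Fin.≟ j)

≡ᵇ-false⇒≢ : ∀ {n} {i j : Fin n} → (i ≡ᵇ j) ≡ false → i ≢ j
≡ᵇ-false⇒≢ {i = i} e refl with () ← trans (sym (≡ᵇ-refl i)) e

≡ᵇ-sym : ∀ {n} (i j : Fin n) → (i ≡ᵇ j) ≡ (j ≡ᵇ i)
≡ᵇ-sym i j with i Fin.≟ j
... | yes refl = sym (≡ᵇ-refl i)
... | no i≢j = sym (≢⇒≡ᵇ-false (λ j≡i → i≢j (sym j≡i)))

-- Counting

sum-mono-≤ : ∀ {n} {f g : Fin n → ℕ} → (∀ i → f i ≤ g i) → sum f ≤ sum g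
sum-mono-≤ {zero} f≤g = z≤n
sum-mono-≤ {suc n} f≤g = +-mono-≤ (f≤g fz) (sum-mono-≤ (λ i → f≤g (fs i)))

count : ∀ {n} → (Fin n → Bool) → ℕ
count p = sum (λ i → toℕ (p i))

_∖_ : ∀ {n} → (Fin n → Bool) → Fin n → (Fin n → Bool)
(p ∖ v) i = p i ∧ not (v ≡ᵇ i)

module _ {n : ℕ} {p : Fin n → Bool} {v i : Fin n} where

  ∖-intro : p i ≡ true → v ≢ i → (p ∖ v) i ≡ true
  ∖-intro pi v≢i = ∧-true pi (not-false (≢⇒≡ᵇ-false v≢i))

  ∖-member : (p ∖ v) i ≡ true → p i ≡ true
  ∖-member = ∧-trueˡ

  ∖-≢ : (p ∖ v) i ≡ true → v ≢ i
  ∖-≢ e = ≡ᵇ-false⇒≢ (not-true (∧-trueʳ {p i} e))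

count-all : ∀ n → count {n} (λ _ → true) ≡ n
count-all zero = refl
count-all (suc n) = cong suc (count-all n)

countTrue≡count : ∀ {n} (p : Fin n → Bool) → countTrue p ≡ count p
countTrue≡count {zero} p = refl
countTrue≡count {suc n} p with p fz
... | true = cong suc (countTrue≡count (p ∘ fs))
... | false = countTrue≡count (p ∘ fs)

count-cong : ∀ {n} {p q : Fin n → Bool} → (∀ i → p i ≡ q i) → count p ≡ count q
count-cong e = sum-cong-≗ (λ i → cong toℕ (e i))

count-remove : ∀ {n} (p : Fin n → Bool) (v : Fin n) → count p ≡ toℕ (p v) + count (p ∖ v)
count-remove {suc n} p fz = cong (toℕ (p fz) +_) (begin
  count (p ∘ fs)         ≡⟨ count-cong (λ i → sym (∧-identityʳ (p (fs i)))) ⟩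
  count ((p ∖ fz) ∘ fs)  ≡⟨ cong (λ b → toℕ b + count ((p ∖ fz) ∘ fs)) (∧-zeroʳ (p fz)) ⟨
  count (p ∖ fz)         ∎)
  where open ≡-Reasoning
count-remove {suc n} p (fs v) = begin
  toℕ (p fz) + count (p ∘ fs)             ≡⟨ cong (toℕ (p fz) +_) (count-remove (p ∘ fs) v) ⟩
  toℕ (p fz) + (toℕ (p (fs v)) + rest)    ≡⟨ x+[y+z]≡y+[x+z] (toℕ (p fz)) (toℕ (p (fs v))) rest ⟩
  toℕ (p (fs v)) + (toℕ (p fz) + rest)    ≡⟨ cong (λ b → toℕ (p (fs v)) + (toℕ b + rest)) (∧-identityʳ (p fz)) ⟨
  toℕ (p (fs v)) + count (p ∖ fs v)       ∎
  where
  open ≡-Reasoning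
  rest : ℕ
  rest = count ((p ∘ fs) ∖ v)
  x+[y+z]≡y+[x+z] : ∀ x y z → x + (y + z) ≡ y + (x + z)
  x+[y+z]≡y+[x+z] = solve-∀

module _ {n : ℕ} where

  count-≤ : ∀ {p q : Fin n → Bool} → (∀ i → p i ≡ true → q i ≡ true) → count p ≤ count q
  count-≤ {p} {q} p⊆q = sum-mono-≤ pt
    where
    pt : ∀ i → toℕ (p i) ≤ toℕ (q i)
    pt i with p i in pi
    ... | false = z≤n
    ... | true rewrite p⊆q i pi = s≤s z≤n

  count-≤n : (p : Fin n → Bool) → count p ≤ n
  count-≤n p = subst (count p ≤_) (count-all n) (count-≤ λ _ _ → refl)

  count-false : (p : Fin n → Bool) → (∀ i → p i ≡ false) → count p ≡ 0
  count-false p h = trans (count-cong h) (sum-replicate-zero n)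

  count-remove-true : (p : Fin n → Bool) {v : Fin n} → p v ≡ true → count p ≡ suc (count (p ∖ v))
  count-remove-true p {v} pv = trans (count-remove p v) (cong (λ b → toℕ b + count (p ∖ v)) pv)

  count-remove-pair : (p : Fin n → Bool) {y z : Fin n} → y ≢ z → p y ≡ true → p z ≡ true →
                      count p ≡ 2 + count ((p ∖ y) ∖ z)
  count-remove-pair p {y} y≢z py pz =
    trans (count-remove-true p py) (cong suc (count-remove-true (p ∖ y) (∖-intro {p = p} pz y≢z)))

  count-< : ∀ {p q : Fin n → Bool} (v : Fin n) → (∀ i → p i ≡ true → q i ≡ true) →
            p v ≡ false → q v ≡ true → count p < count q
  count-< {p} {q} v p⊆q pv qv = begin-strict
    count p                    ≡⟨ count-remove p v ⟩
    toℕ (p v) + count (p ∖ v)  ≡⟨ cong (λ b → toℕ b + count (p ∖ v)) pv ⟩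
    count (p ∖ v)              <⟨ s≤s (count-≤ p∖v⊆q∖v) ⟩
    suc (count (q ∖ v))        ≡⟨ count-remove-true q qv ⟨
    count q                    ∎
    where
    open ≤-Reasoning
    p∖v⊆q∖v : ∀ i → (p ∖ v) i ≡ true → (q ∖ v) i ≡ true
    p∖v⊆q∖v i e = ∖-intro {p = q} (p⊆q i (∖-member {p = p} {v} e)) (∖-≢ {p = p} {v} e)

  count-pos : (p : Fin n → Bool) → 0 < count p → ∃ λ i → p i ≡ true
  count-pos p pos with any? (λ i → p i Bool.≟ true)
  ... | yes found = found
  ... | no none = contradiction (count-false p (λ i → ¬-not (λ pi → none (i , pi)))) (>⇒≢ pos)

  count≡0⇒false : (p : Fin n → Bool) → count p ≡ 0 → ∀ i → p i ≡ false
  count≡0⇒false p p≡0 i with p i in pi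
  ... | false = refl
  ... | true = contradiction (trans (sym (count-remove-true p pi)) p≡0) λ ()

  count-≤1 : (p : Fin n → Bool) → (∀ i j → p i ≡ true → p j ≡ true → i ≡ j) → count p ≤ 1
  count-≤1 p unique with count p ≟ 0
  ... | yes p≡0 = ≤-trans (≤-reflexive p≡0) z≤n
  ... | no p≢0 with count-pos p (n≢0⇒n>0 p≢0)
  ... | i , pi = ≤-reflexive (trans (count-remove-true p pi) (cong suc (count-false (p ∖ i) others)))
    where
    others : ∀ j → (p ∖ i) j ≡ false
    others j with p j in pj
    ... | false = refl
    ... | true rewrite unique i j pi pj | ≡ᵇ-refl j = refl

  count-singleton : (v : Fin n) → count (v ≡ᵇ_) ≡ 1
  count-singleton v = trans (count-remove-true (v ≡ᵇ_) (≡ᵇ-refl v)) (cong suc (count-false ((v ≡ᵇ_) ∖ v) others))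
    where
    others : ∀ i → ((v ≡ᵇ_) ∖ v) i ≡ false
    others i with v ≡ᵇ i
    ... | true = refl
    ... | false = refl

  count-split : (p q : Fin n → Bool) → count p ≡ count (λ i → p i ∧ q i) + count (λ i → p i ∧ not (q i))
  count-split p q = trans (sum-cong-≗ pt) (∑-distrib-+ (λ i → toℕ (p i ∧ q i)) (λ i → toℕ (p i ∧ not (q i))))
    where
    pt : ∀ i → toℕ (p i) ≡ toℕ (p i ∧ q i) + toℕ (p i ∧ not (q i))
    pt i with p i | q i
    ... | true  | true  = refl
    ... | true  | false = refl
    ... | false | _     = refl

  count-exactly-one : (p q r : Fin n → Bool) → (∀ i → toℕ (p i) + (toℕ (q i) + toℕ (r i)) ≡ 1) →
                      count p + (count q + count r) ≡ n
  count-exactly-one p q r one = begin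
    count p + (count q + count r)                    ≡⟨ cong (count p +_) (∑-distrib-+ (toℕ ∘ q) (toℕ ∘ r)) ⟨
    count p + sum (λ i → toℕ (q i) + toℕ (r i))      ≡⟨ ∑-distrib-+ (toℕ ∘ p) (λ i → toℕ (q i) + toℕ (r i)) ⟨
    sum (λ i → toℕ (p i) + (toℕ (q i) + toℕ (r i)))  ≡⟨ sum-cong-≗ one ⟩
    count {n} (λ _ → true)                           ≡⟨ count-all n ⟩
    n                                                ∎
    where open ≡-Reasoning

  count-exchange : (p q : Fin n → Bool) {y z : Fin n} → p y ≡ false → q y ≡ true → p z ≡ true → q z ≡ false →
                   (∀ i → y ≢ i → z ≢ i → p i ≡ q i) → count p ≡ count q
  count-exchange p q {y} {z} py qy pz qz elsewhere = begin
    count p              ≡⟨ count-remove-true p pz ⟩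
    suc (count (p ∖ z))  ≡⟨ cong suc (count-cong same) ⟩
    suc (count (q ∖ y))  ≡⟨ count-remove-true q qy ⟨
    count q              ∎
    where
    open ≡-Reasoning
    same : ∀ i → (p ∖ z) i ≡ (q ∖ y) i
    same i with y Fin.≟ i | z Fin.≟ i
    ... | yes refl | _ rewrite py = sym (∧-zeroʳ (q y))
    ... | no _ | yes refl rewrite qz = ∧-zeroʳ (p z)
    ... | no y≢i | no z≢i = cong (_∧ true) (elsewhere i y≢i z≢i)

  toℕ*count : ∀ b (p : Fin n → Bool) → toℕ b * count p ≡ count (λ i → b ∧ p i)
  toℕ*count true p = +-identityʳ (count p)
  toℕ*count false p = sym (sum-replicate-zero n)

  sum-split : (p q : Fin n → Bool) (f : Fin n → ℕ) →
              sum (λ i → toℕ (p i) * f i) ≡ sum (λ i → toℕ (p i ∧ q i) * f i) + sum (λ i → toℕ (p i ∧ not (q i)) * f i)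
  sum-split p q f = trans (sum-cong-≗ pt) (∑-distrib-+ (λ i → toℕ (p i ∧ q i) * f i) (λ i → toℕ (p i ∧ not (q i)) * f i))
    where
    pt : ∀ i → toℕ (p i) * f i ≡ toℕ (p i ∧ q i) * f i + toℕ (p i ∧ not (q i)) * f i
    pt i with p i | q i
    ... | true  | true  = sym (+-identityʳ _)
    ... | true  | false = refl
    ... | false | _     = refl

  count*≤sum : (p : Fin n → Bool) (f : Fin n → ℕ) {c : ℕ} → (∀ i → p i ≡ true → c ≤ f i) →
               count p * c ≤ sum (λ i → toℕ (p i) * f i)
  count*≤sum p f {c} c≤f = ≤-trans (≤-reflexive (*-distribʳ-sum c (λ i → toℕ (p i)))) (sum-mono-≤ pt)
    where
    pt : ∀ i → toℕ (p i) * c ≤ toℕ (p i) * f i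
    pt i with p i in pi
    ... | true = *-monoʳ-≤ 1 (c≤f i pi)
    ... | false = z≤n

  sum-disjoint-≤ : (U X : Fin n → Bool) (C : Fin n → Fin n → Bool) →
    (∀ w w' y → U w ≡ true → U w' ≡ true → C w y ≡ true → C w' y ≡ true → w ≡ w') →
    sum (λ w → toℕ (U w) * count (λ v → X v ∧ C w v)) ≤ count X
  sum-disjoint-≤ U X C disjoint = begin
    sum (λ w → toℕ (U w) * count (λ v → X v ∧ C w v))
      ≡⟨ sum-cong-≗ (λ w → *-distribˡ-sum (toℕ (U w)) (λ v → toℕ (X v ∧ C w v))) ⟩
    sum (λ w → sum (λ v → toℕ (U w) * toℕ (X v ∧ C w v)))
      ≡⟨ ∑-comm (λ w v → toℕ (U w) * toℕ (X v ∧ C w v)) ⟩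
    sum (λ v → sum (λ w → toℕ (U w) * toℕ (X v ∧ C w v)))
      ≡⟨ sum-cong-≗ (λ v → sum-cong-≗ (λ w → swap (U w) (X v) (C w v))) ⟩
    sum (λ v → sum (λ w → toℕ (X v) * toℕ (U w ∧ C w v)))
      ≡⟨ sum-cong-≗ (λ v → *-distribˡ-sum (toℕ (X v)) (λ w → toℕ (U w ∧ C w v))) ⟨
    sum (λ v → toℕ (X v) * count (λ w → U w ∧ C w v))
      ≤⟨ sum-mono-≤ (λ v → *-monoʳ-≤ (toℕ (X v)) (count-≤1 _ (unique v))) ⟩
    sum (λ v → toℕ (X v) * 1)
      ≡⟨ sum-cong-≗ (λ v → *-identityʳ (toℕ (X v))) ⟩
    count X ∎
    where
    open ≤-Reasoning
    swap : ∀ a b c → toℕ a * toℕ (b ∧ c) ≡ toℕ b * toℕ (a ∧ c)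
    swap true  true  c = refl
    swap true  false c = refl
    swap false true  c = refl
    swap false false c = refl
    unique : ∀ v w w' → (U w ∧ C w v) ≡ true → (U w' ∧ C w' v) ≡ true → w ≡ w'
    unique v w w' e e' = disjoint w w' v (∧-trueˡ e) (∧-trueˡ e') (∧-trueʳ e) (∧-trueʳ e')

-- Parity

Even : ℕ → Set
Even x = 2 ∣ x

even-0 : Even 0
even-0 = divides 0 refl

even-+ : ∀ {a b} → Even a → Even b → Even (a + b)
even-+ = ∣m∣n⇒∣m+n

even-2+ : ∀ {a} → Even a → Even (2 + a)
even-2+ = even-+ (divides 1 refl)

even-double : ∀ k → Even (k + k)
even-double k = divides k (trans (cong (k +_) (sym (+-identityʳ k))) (*-comm 2 k))

¬even-1 : ¬ Even 1
¬even-1 (divides (suc q) ())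

odd*odd : ∀ a b → ¬ Even a → ¬ Even b → ¬ Even (a * b)
odd*odd a b odd-a odd-b even-ab with euclidsLemma a b prime[2] even-ab
... | inj₁ even-a = odd-a even-a
... | inj₂ even-b = odd-b even-b

even⊎even-suc : ∀ x → Even x ⊎ Even (suc x)
even⊎even-suc zero = inj₁ even-0
even⊎even-suc (suc x) with even⊎even-suc x
... | inj₁ even-x = inj₂ (even-2+ even-x)
... | inj₂ even-sx = inj₁ even-sx

even-squeeze : ∀ {a b} → Even a → Even b → a < b → b ≤ 2 + a → b ≡ 2 + a
even-squeeze {a} {b} even-a even-b a<b b≤2+a with m≤n⇒m<n∨m≡n b≤2+a
... | inj₂ b≡2+a = b≡2+a
... | inj₁ (s≤s b≤1+a) = contradiction (∣m+n∣m⇒∣n (subst Even (trans (≤-antisym b≤1+a a<b) (+-comm 1 a)) even-b) even-a) ¬even-1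

module _ {n : ℕ} where

  FixedPointFreeInvolutionOn : (Fin n → Fin n) → (Fin n → Bool) → Set
  FixedPointFreeInvolutionOn f P = ∀ y → P y ≡ true → P (f y) ≡ true × f (f y) ≡ y × f y ≢ y

  even-count-involution : (f : Fin n → Fin n) (P : Fin n → Bool) →
                          FixedPointFreeInvolutionOn f P → Even (count P)
  even-count-involution f P inv = go (count P) P ≤-refl inv
    where
    go : ∀ k P → count P ≤ k → FixedPointFreeInvolutionOn f P → Even (count P)
    go k P bound inv with count P ≟ 0
    ... | yes P≡0 = subst Even (sym P≡0) even-0
    ... | no P≢0 with count-pos P (n≢0⇒n>0 P≢0) | k
    ... | y , Py | zero = contradiction (n≤0⇒n≡0 bound) P≢0
    ... | y , Py | suc k with inv y Py
    ... | Pfy , ffy≡y , fy≢y = subst Even (sym P≡2+P') (even-2+ (go k P' bound' inv'))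
      where
      P' : Fin n → Bool
      P' = (P ∖ y) ∖ f y
      P≡2+P' : count P ≡ 2 + count P'
      P≡2+P' = count-remove-pair P (λ e → fy≢y (sym e)) Py Pfy
      bound' : count P' ≤ k
      bound' = ≤-pred (≤-trans (n≤1+n _) (subst (_≤ suc k) P≡2+P' bound))
      inv' : FixedPointFreeInvolutionOn f P'
      inv' z P'z with inv z (∖-member {p = P} {y} (∖-member {p = P ∖ y} {f y} P'z))
      ... | Pfz , ffz≡z , fz≢z = ∖-intro {p = P ∖ y} (∖-intro {p = P} Pfz y≢fz) fy≢fz , ffz≡z , fz≢z
        where
        y≢fz : y ≢ f z
        y≢fz y≡fz = ∖-≢ {p = P ∖ y} {f y} P'z (trans (cong f y≡fz) ffz≡z)
        fy≢fz : f y ≢ f z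
        fy≢fz fy≡fz = ∖-≢ {p = P} {y} (∖-member {p = P ∖ y} {f y} P'z) (trans (sym ffy≡y) (trans (cong f fy≡fz) ffz≡z))

handshake : ∀ {n} (R : Fin n → Fin n → Bool) → (∀ i j → R i j ≡ R j i) → (∀ i → R i i ≡ false) →
            Even (sum (λ i → count (R i)))
handshake {zero} R R-sym R-irrefl = even-0
handshake {suc n} R R-sym R-irrefl =
  subst Even (sym degrees) (even-+ (even-double (count (R fz ∘ fs))) (handshake R' (λ i j → R-sym (fs i) (fs j)) (R-irrefl ∘ fs)))
  where
  R' : Fin n → Fin n → Bool
  R' i j = R (fs i) (fs j)
  d₀ : ℕ
  d₀ = count (R fz ∘ fs)
  degrees : sum (λ i → count (R i)) ≡ d₀ + d₀ + sum (λ i → count (R' i))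
  degrees = begin
    toℕ (R fz fz) + d₀ + sum (λ i → toℕ (R (fs i) fz) + count (R' i))
      ≡⟨ cong (λ b → toℕ b + d₀ + sum (λ i → toℕ (R (fs i) fz) + count (R' i))) (R-irrefl fz) ⟩
    d₀ + sum (λ i → toℕ (R (fs i) fz) + count (R' i))
      ≡⟨ cong (d₀ +_) (∑-distrib-+ (λ i → toℕ (R (fs i) fz)) (λ i → count (R' i))) ⟩
    d₀ + (count (λ i → R (fs i) fz) + sum (λ i → count (R' i)))
      ≡⟨ cong (λ x → d₀ + (x + sum (λ i → count (R' i)))) (count-cong (λ i → R-sym (fs i) fz)) ⟩
    d₀ + (d₀ + sum (λ i → count (R' i)))
      ≡⟨ +-assoc d₀ d₀ _ ⟨
    d₀ + d₀ + sum (λ i → count (R' i)) ∎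
    where open ≡-Reasoning

¬¬-∀-Fin : ∀ {n} {A : Fin n → Set} → (∀ i → DoubleNegation (A i)) → DoubleNegation (∀ i → A i)
¬¬-∀-Fin {zero} h k = k (λ ())
¬¬-∀-Fin {suc n} {A} h k = h fz λ a₀ → ¬¬-∀-Fin {n} {A ∘ fs} (h ∘ fs) λ rest → k λ { fz → a₀ ; (fs i) → rest i }

no-minimal⇒empty : ∀ {A : Set} (μ : A → ℕ) → (∀ a → ¬ (∀ b → μ b ≮ μ a)) → ¬ A
no-minimal⇒empty μ h = All.wfRec (On.wellFounded μ <-wellFounded) _ (λ _ → ⊥)
                         λ a ih → h a (λ b μb<μa → ih μb<μa)

no-maximal⇒empty : ∀ {A : Set} (μ : A → ℕ) (B : ℕ) → (∀ a → μ a ≤ B) → (∀ a → ¬ (∀ b → μ a ≮ μ b)) → ¬ A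
no-maximal⇒empty μ B bounded h = no-minimal⇒empty (λ a → B ∸ μ a)
  λ a maximal → h a λ b μa<μb → maximal b (∸-monoʳ-< μa<μb (bounded b))

d≤c*[1+d∸c] : ∀ {c d} → 1 ≤ c → c ≤ d → d ≤ c * (suc d ∸ c)
d≤c*[1+d∸c] {c@(suc _)} {d} _ c≤d with j , refl ← m≤n⇒∃[o]m+o≡n c≤d = begin
  c + j                  ≤⟨ +-monoʳ-≤ c (m≤n*m j c) ⟩
  c + c * j              ≡⟨ *-suc c j ⟨
  c * suc j              ≡⟨ cong (c *_) (m+n∸m≡n c (suc j)) ⟨
  c * (c + suc j ∸ c)    ≡⟨ cong (λ x → c * (x ∸ c)) (+-suc c j) ⟩
  c * (suc (c + j) ∸ c)  ∎
  where open ≤-Reasoning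

private
  [m+2]*n≡m*n+[n+n] : ∀ m n → (m + 2) * n ≡ m * n + (n + n)
  [m+2]*n≡m*n+[n+n] = solve-∀

  [m+1]*n≡m*n+n : ∀ m n → (m + 1) * n ≡ m * n + n
  [m+1]*n≡m*n+n = solve-∀

  3*[2+n]≡3*n+6 : ∀ n → 3 * (2 + n) ≡ 3 * n + 6
  3*[2+n]≡3*n+6 = solve-∀

  s*d<A*d+B : ∀ A B s d → 1 ≤ d → B ≤ 2 → s + 2 ≤ A + B → s * d < A * d + B
  s*d<A*d+B A 0 s d 1≤d _ s+2≤A+0 = begin-strict
    s * d            <⟨ m<m+n (s * d) (≤-trans 1≤d (m≤m+n d d)) ⟩
    s * d + (d + d)  ≡⟨ [m+2]*n≡m*n+[n+n] s d ⟨
    (s + 2) * d      ≤⟨ *-monoˡ-≤ d (subst (s + 2 ≤_) (+-identityʳ A) s+2≤A+0) ⟩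
    A * d            ≡⟨ +-identityʳ (A * d) ⟨
    A * d + 0        ∎
    where open ≤-Reasoning
  s*d<A*d+B A 1 s d 1≤d _ s+2≤A+1 = begin-strict
    s * d            <⟨ m<m+n (s * d) 1≤d ⟩
    s * d + d        ≡⟨ [m+1]*n≡m*n+n s d ⟨
    (s + 1) * d      ≤⟨ *-monoˡ-≤ d (+-cancelʳ-≤ 1 (s + 1) A (subst (_≤ A + 1) (sym (+-assoc s 1 1)) s+2≤A+1)) ⟩
    A * d            <⟨ m<m+n (A * d) (s≤s z≤n) ⟩
    A * d + 1        ∎
    where open ≤-Reasoning
  s*d<A*d+B A 2 s d 1≤d _ s+2≤A+2 = begin-strict
    s * d            ≤⟨ *-monoˡ-≤ d (+-cancelʳ-≤ 2 s A s+2≤A+2) ⟩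
    A * d            <⟨ m<m+n (A * d) (s≤s z≤n) ⟩
    A * d + 2        ∎
    where open ≤-Reasoning
  s*d<A*d+B A (suc (suc (suc _))) s d _ (s≤s (s≤s ())) _

-- In the application A and B count the odd components with at most d and with more than d
-- vertices, s is the number of deleted vertices and w the number of remaining ones.
component-bounds-absurd : ∀ A B s d w → 1 ≤ d → A * d + B ≤ s * d → B * (2 + d) ≤ w → w + s ≤ 3 * d + 6 →
                          s + 2 ≤ A + B → ⊥
component-bounds-absurd A B zero d@(suc _) w _ A*d+B≤0 _ _ 2≤A+B =
  contradiction (≤-trans 2≤A+B (+-mono-≤ (≤-trans (m≤m*n A d) A*d≤0) B≤0)) λ ()
  where
  A*d≤0 : A * d ≤ 0
  A*d≤0 = ≤-trans (m≤m+n (A * d) B) A*d+B≤0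
  B≤0 : B ≤ 0
  B≤0 = ≤-trans (m≤n+m B (A * d)) A*d+B≤0
component-bounds-absurd A B (suc s) d w 1≤d A*d+B≤s*d B[2+d]≤w w+s≤3d+6 s+2≤A+B with B ≤? 2
... | yes B≤2 = <-irrefl refl (<-≤-trans (s*d<A*d+B A B (suc s) d 1≤d B≤2 s+2≤A+B) A*d+B≤s*d)
... | no B≰2 = <-irrefl refl (begin-strict
  3 * (2 + d)  ≤⟨ *-monoˡ-≤ (2 + d) (≰⇒> B≰2) ⟩
  B * (2 + d)  ≤⟨ B[2+d]≤w ⟩
  w            <⟨ m<m+n w (s≤s z≤n) ⟩
  w + suc s    ≤⟨ w+s≤3d+6 ⟩
  3 * d + 6    ≡⟨ 3*[2+n]≡3*n+6 d ⟨
  3 * (2 + d)  ∎)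
  where open ≤-Reasoning

r≤3d+6 : ∀ {n r d} → n ≡ d + suc r → (n ≥ 64 × 4 * r < 3 * n) ⊎ (n < 64 × r + 16 < n) → r ≤ 3 * d + 6
r≤3d+6 {n} {r} {d} refl (inj₁ (_ , 4r<3n)) =
  ≤-trans (≤-pred (≤-trans 1+r≤3d+3 (n≤1+n _))) (≤-trans (m≤m+n (3 * d + 3) 3) (≤-reflexive (+-assoc (3 * d) 3 3)))
  where
  1+r≤3d+3 : suc r ≤ 3 * d + 3
  1+r≤3d+3 = +-cancelʳ-≤ (3 * r) (suc r) (3 * d + 3) (subst₂ _≤_ (lhs r) (rhs d r) 4r<3n)
    where
    lhs : ∀ r → suc (4 * r) ≡ suc r + 3 * r
    lhs = solve-∀
    rhs : ∀ d r → 3 * (d + suc r) ≡ (3 * d + 3) + 3 * r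
    rhs = solve-∀
r≤3d+6 {n} {r} {d} refl (inj₂ (n<64 , r+16<n)) = ≤-trans r≤46 (≤-trans (m≤m+n 46 8) (+-monoˡ-≤ 6 (*-monoʳ-≤ 3 16≤d)))
  where
  r≤46 : r ≤ 46
  r≤46 = ≤-pred (+-cancelʳ-≤ 16 (suc r) 47 (≤-trans r+16<n (≤-pred n<64)))
  16≤d : 16 ≤ d
  16≤d = ≤-pred (+-cancelˡ-≤ r 17 (suc d) (≤-trans (≤-reflexive (+-suc r 16))
                                                   (≤-trans r+16<n (≤-reflexive (trans (+-comm d (suc r)) (sym (+-suc r d)))))))

-- Matchings

_[_≔_] : ∀ {A : Set} {n} → (Fin n → A) → Fin n → A → (Fin n → A)
f [ i ≔ a ] = updateAt f i (const a)

≔-same : ∀ {A : Set} {n} (f : Fin n → A) (i : Fin n) {a : A} → (f [ i ≔ a ]) i ≡ a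
≔-same f i = updateAt-updates i f

≔-other : ∀ {A : Set} {n} (f : Fin n → A) {i j : Fin n} {a : A} → i ≢ j → (f [ i ≔ a ]) j ≡ f j
≔-other f {i} {j} i≢j = updateAt-minimal j i f (≢-sym i≢j)

module Matchings {n : ℕ} (E : Fin n → Fin n → Bool)
  (E-sym : ∀ u v → E u v ≡ E v u) (E-irrefl : ∀ u → E u u ≡ false) where

  VertexSet : Set
  VertexSet = Fin n → Bool

  _⊆_ : VertexSet → VertexSet → Set
  W' ⊆ W = ∀ u → W' u ≡ true → W u ≡ true

  E⇒≢ : ∀ {u v} → E u v ≡ true → u ≢ v
  E⇒≢ {u} Euv refl with () ← trans (sym Euv) (E-irrefl u)

  record Matching (W : VertexSet) : Set where
    field
      mate : Fin n → Maybe (Fin n)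
      mate-edge : ∀ u w → mate u ≡ just w → W u ≡ true × W w ≡ true × E u w ≡ true × mate w ≡ just u
  open Matching public

  module _ {W : VertexSet} where

    covered : Matching W → VertexSet
    covered M u = is-just (mate M u)

    size : Matching W → ℕ
    size M = count (covered M)

    exposed : Matching W → VertexSet
    exposed M u = W u ∧ not (covered M u)

    deficiency : Matching W → ℕ
    deficiency M = count (exposed M)

    Maximum : Matching W → Set
    Maximum M = ∀ (M' : Matching W) → size M' ≤ size M

    covered⊆W : (M : Matching W) → covered M ⊆ W
    covered⊆W M u c with mate M u in e
    ... | just w = proj₁ (mate-edge M u w e)

    exposed-mate : (M : Matching W) {u : Fin n} → exposed M u ≡ true → mate M u ≡ nothing
    exposed-mate M {u} e with mate M u | ∧-trueʳ {W u} e
    ... | nothing | _ = refl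

    exposed-intro : (M : Matching W) {u : Fin n} → W u ≡ true → mate M u ≡ nothing → exposed M u ≡ true
    exposed-intro M Wu mu = ∧-true Wu (not-false (cong is-just mu))

    count≡size+deficiency : (M : Matching W) → count W ≡ size M + deficiency M
    count≡size+deficiency M = trans (count-split W (covered M)) (cong (_+ deficiency M) (count-cong pt))
      where
      pt : ∀ i → (W i ∧ covered M i) ≡ covered M i
      pt i with covered M i in c
      ... | false = ∧-zeroʳ (W i)
      ... | true rewrite covered⊆W M i c = refl

    partner : Matching W → Fin n → Fin n
    partner M u with mate M u
    ... | just w = w
    ... | nothing = u

    partner-mate : (M : Matching W) {u w : Fin n} → mate M u ≡ just w → partner M u ≡ w
    partner-mate M {u} e with mate M u
    partner-mate M refl | .(just _) = refl

    partner-involution : (M : Matching W) → FixedPointFreeInvolutionOn (partner M) (covered M)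
    partner-involution M y c with mate M y in e
    ... | just w with mate-edge M y w e
    ... | _ , _ , Eyw , mw≡y = cong is-just mw≡y , partner-mate M mw≡y , λ w≡y → E⇒≢ Eyw (sym w≡y)

    size-even : (M : Matching W) → Even (size M)
    size-even M = even-count-involution (partner M) (covered M) (partner-involution M)

    restrict : ∀ {W'} → W ⊆ W' → Matching W → Matching W'
    restrict {W'} W⊆W' M = record { mate = mate M ; mate-edge = edge }
      where
      edge : ∀ u w → mate M u ≡ just w → W' u ≡ true × W' w ≡ true × E u w ≡ true × mate M w ≡ just u
      edge u w e with mate-edge M u w e
      ... | Wu , Ww , Euw , mw = W⊆W' u Wu , W⊆W' w Ww , Euw , mw

    empty : Matching W
    empty = record { mate = λ _ → nothing ; mate-edge = λ _ _ () }

    exposed≢matched : (M : Matching W) {x w u : Fin n} → mate M x ≡ nothing → mate M w ≡ just u → x ≢ w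
    exposed≢matched M mx mw refl with () ← trans (sym mx) mw

    module AddEdge (M : Matching W) {x y : Fin n} (mx : mate M x ≡ nothing) (my : mate M y ≡ nothing)
                   (Wx : W x ≡ true) (Wy : W y ≡ true) (Exy : E x y ≡ true) where

      x≢y : x ≢ y
      x≢y = E⇒≢ Exy

      mate' : Fin n → Maybe (Fin n)
      mate' = (mate M [ y ≔ just x ]) [ x ≔ just y ]

      mate'-x : mate' x ≡ just y
      mate'-x = ≔-same _ x

      mate'-y : mate' y ≡ just x
      mate'-y = trans (≔-other _ x≢y) (≔-same _ y)

      mate'-other : ∀ {u} → x ≢ u → y ≢ u → mate' u ≡ mate M u
      mate'-other x≢u y≢u = trans (≔-other _ x≢u) (≔-other _ y≢u)

      edge : ∀ u w → mate' u ≡ just w → W u ≡ true × W w ≡ true × E u w ≡ true × mate' w ≡ just u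
      edge u w e with x Fin.≟ u | y Fin.≟ u
      ... | yes refl | _ with refl ← just-injective (trans (sym mate'-x) e) = Wx , Wy , Exy , mate'-y
      ... | no x≢u | yes refl with refl ← just-injective (trans (sym mate'-y) e) = Wy , Wx , trans (E-sym y x) Exy , mate'-x
      ... | no x≢u | no y≢u with mate-edge M u w (trans (sym (mate'-other x≢u y≢u)) e)
      ... | Wu , Ww , Euw , mw = Wu , Ww , Euw , trans (mate'-other (exposed≢matched M mx mw) (exposed≢matched M my mw)) mw

      M' : Matching W
      M' = record { mate = mate' ; mate-edge = edge }

      size-< : size M < size M'
      size-< = count-< x grows (cong is-just mx) (cong is-just mate'-x)
        where
        grows : covered M ⊆ covered M'
        grows u c with mate M u in mu
        ... | just w = cong is-just (trans (mate'-other (exposed≢matched M mx mu) (exposed≢matched M my mu)) mu)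

    maximum⇒exposed-independent : (M : Matching W) → Maximum M → ∀ {x y} → mate M x ≡ nothing → mate M y ≡ nothing →
                                   W x ≡ true → W y ≡ true → E x y ≡ true → ⊥
    maximum⇒exposed-independent M maximum mx my Wx Wy Exy = <⇒≱ (AddEdge.size-< M mx my Wx Wy Exy) (maximum (AddEdge.M' M mx my Wx Wy Exy))

    agreement : Matching W → Matching W → VertexSet
    agreement M N u = does (≡-dec Fin._≟_ (mate M u) (mate N u))

    agreement-intro : (M N : Matching W) {u : Fin n} → mate M u ≡ mate N u → agreement M N u ≡ true
    agreement-intro M N {u} = dec-true (≡-dec Fin._≟_ (mate M u) (mate N u))

    agreement-elim : (M N : Matching W) {u : Fin n} → agreement M N u ≡ true → mate M u ≡ mate N u
    agreement-elim M N {u} = does-true⇒ (≡-dec Fin._≟_ (mate M u) (mate N u))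

    -- Trading the edge t z of N for y t keeps N maximum and frees z.
    module Swap (N : Matching W) {y t z : Fin n} (ny : mate N y ≡ nothing) (nt : mate N t ≡ just z)
                (Wy : W y ≡ true) (Eyt : E y t ≡ true) where

      Wt : W t ≡ true
      Wt = proj₁ (mate-edge N t z nt)
      nz : mate N z ≡ just t
      nz = proj₂ (proj₂ (proj₂ (mate-edge N t z nt)))
      y≢t : y ≢ t
      y≢t = E⇒≢ Eyt
      t≢z : t ≢ z
      t≢z = E⇒≢ (proj₁ (proj₂ (proj₂ (mate-edge N t z nt))))
      y≢z : y ≢ z
      y≢z = exposed≢matched N ny nz

      mate' : Fin n → Maybe (Fin n)
      mate' = ((mate N [ z ≔ nothing ]) [ t ≔ just y ]) [ y ≔ just t ]

      mate'-y : mate' y ≡ just t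
      mate'-y = ≔-same _ y

      mate'-t : mate' t ≡ just y
      mate'-t = trans (≔-other _ y≢t) (≔-same _ t)

      mate'-z : mate' z ≡ nothing
      mate'-z = trans (≔-other _ y≢z) (trans (≔-other _ t≢z) (≔-same _ z))

      mate'-other : ∀ {u} → y ≢ u → t ≢ u → z ≢ u → mate' u ≡ mate N u
      mate'-other y≢u t≢u z≢u = trans (≔-other _ y≢u) (trans (≔-other _ t≢u) (≔-other _ z≢u))

      edge : ∀ u w → mate' u ≡ just w → W u ≡ true × W w ≡ true × E u w ≡ true × mate' w ≡ just u
      edge u w e with y Fin.≟ u | t Fin.≟ u | z Fin.≟ u
      ... | yes refl | _ | _ with refl ← just-injective (trans (sym mate'-y) e) = Wy , Wt , Eyt , mate'-t
      ... | no _ | yes refl | _ with refl ← just-injective (trans (sym mate'-t) e) = Wt , Wy , trans (E-sym t y) Eyt , mate'-y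
      ... | no _ | no _ | yes refl with () ← trans (sym e) mate'-z
      ... | no y≢u | no t≢u | no z≢u with mate-edge N u w (trans (sym (mate'-other y≢u t≢u z≢u)) e)
      ... | Wu , Ww , Euw , nw = Wu , Ww , Euw , trans (mate'-other (exposed≢matched N ny nw) t≢w z≢w) nw
        where
        t≢w : t ≢ w
        t≢w refl = z≢u (just-injective (trans (sym nt) nw))
        z≢w : z ≢ w
        z≢w refl = t≢u (just-injective (trans (sym nz) nw))

      N' : Matching W
      N' = record { mate = mate' ; mate-edge = edge }

      size-≡ : size N ≡ size N'
      size-≡ = count-exchange (covered N) (covered N') (cong is-just ny) (cong is-just mate'-y)
                 (cong is-just nz) (cong is-just mate'-z) elsewhere
        where
        elsewhere : ∀ i → y ≢ i → z ≢ i → covered N i ≡ covered N' i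
        elsewhere i y≢i z≢i with t Fin.≟ i
        ... | yes refl = trans (cong is-just nt) (cong is-just (sym mate'-t))
        ... | no t≢i = cong is-just (sym (mate'-other y≢i t≢i z≢i))

      agreement-< : (M : Matching W) → mate M y ≡ just t → count (agreement M N) < count (agreement M N')
      agreement-< M my = count-< y kept (cong₂ (λ a b → does (≡-dec Fin._≟_ a b)) my ny) (agreement-intro M N' (trans my (sym mate'-y)))
        where
        mt : mate M t ≡ just y
        mt = proj₂ (proj₂ (proj₂ (mate-edge M y t my)))
        kept : agreement M N ⊆ agreement M N'
        kept i agree with M≡N ← agreement-elim M N agree | y Fin.≟ i | t Fin.≟ i | z Fin.≟ i
        ... | yes refl | _ | _ = agreement-intro M N' (trans my (sym mate'-y))
        ... | no _ | yes refl | _ = agreement-intro M N' (trans mt (sym mate'-t))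
        ... | no _ | no _ | yes refl =
          contradiction (just-injective (trans (sym mt) (proj₂ (proj₂ (proj₂ (mate-edge M z t (trans M≡N nz))))))) y≢z
        ... | no y≢i | no t≢i | no z≢i = agreement-intro M N' (trans M≡N (sym (mate'-other y≢i t≢i z≢i)))

  data Walk (W : VertexSet) : Fin n → Fin n → Set where
    nil  : ∀ {u} → W u ≡ true → Walk W u u
    cons : ∀ {u x v} → W u ≡ true → E u x ≡ true → Walk W x v → Walk W u v

  module _ {W : VertexSet} where

    length : ∀ {u v} → Walk W u v → ℕ
    length (nil _) = 0
    length (cons _ _ p) = suc (length p)

    length-pos : ∀ {u v} → u ≢ v → (p : Walk W u v) → 0 < length p
    length-pos u≢v (nil _) = contradiction refl u≢v
    length-pos u≢v (cons _ _ _) = s≤s z≤n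

    start : ∀ {u v} → Walk W u v → W u ≡ true
    start (nil Wu) = Wu
    start (cons Wu _ _) = Wu

    end : ∀ {u v} → Walk W u v → W v ≡ true
    end (nil Wv) = Wv
    end (cons _ _ p) = end p

    snoc : ∀ {u v x} → Walk W u v → W x ≡ true → E v x ≡ true → Walk W u x
    snoc (nil Wu) Wx Eux = cons Wu Eux (nil Wx)
    snoc (cons Wu Euy p) Wx Evx = cons Wu Euy (snoc p Wx Evx)

    _++_ : ∀ {u v x} → Walk W u v → Walk W v x → Walk W u x
    nil _ ++ q = q
    cons Wu Euy p ++ q = cons Wu Euy (p ++ q)

    reverse : ∀ {u v} → Walk W u v → Walk W v u
    reverse (nil Wu) = nil Wu
    reverse (cons {u} {x} Wu Eux p) = snoc (reverse p) Wu (trans (E-sym x u) Eux)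

    ExposedSeparated : Matching W → Set
    ExposedSeparated M = ∀ {u v} → exposed M u ≡ true → exposed M v ≡ true → u ≢ v → ¬ Walk W u v

    Avoidable : Fin n → Set
    Avoidable v = Σ (Matching W) λ N → Maximum N × mate N v ≡ nothing

    maximum-deficiency-≡ : (M N : Matching W) → Maximum M → Maximum N → deficiency M ≡ deficiency N
    maximum-deficiency-≡ M N maxM maxN = +-cancelˡ-≡ (size M) (deficiency M) (deficiency N) (begin
      size M + deficiency M  ≡⟨ count≡size+deficiency M ⟨
      count W                ≡⟨ count≡size+deficiency N ⟩
      size N + deficiency N  ≡⟨ cong (_+ deficiency N) (≤-antisym (maxM N) (maxN M)) ⟩
      size M + deficiency N  ∎)
      where open ≡-Reasoning

    exposed-shift : (M N : Matching W) {x u v : Fin n} → u ≢ v → exposed M u ≡ true → exposed M v ≡ true →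
                    covered N u ≡ true → covered N v ≡ true → exposed N x ≡ true →
                    (∀ y → exposed N y ≡ true → x ≢ y → exposed M y ≡ true) → deficiency N < deficiency M
    exposed-shift M N {x} {u} {v} u≢v eu ev cu cv ex only = begin-strict
      deficiency N                     ≡⟨ count-remove-true (exposed N) ex ⟩
      suc (count (exposed N ∖ x))      <⟨ s≤s (s≤s (count-≤ fewer)) ⟩
      2 + count ((exposed M ∖ u) ∖ v)  ≡⟨ count-remove-pair (exposed M) u≢v eu ev ⟨
      deficiency M                     ∎
      where
      open ≤-Reasoning
      covered≢ : ∀ {w i} → covered N w ≡ true → exposed N i ≡ true → w ≢ i
      covered≢ {w} cw ei refl with () ← trans (sym cw) (not-true (∧-trueʳ {W w} ei))
      fewer : (exposed N ∖ x) ⊆ ((exposed M ∖ u) ∖ v)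
      fewer i e = ∖-intro {p = exposed M ∖ u}
                    (∖-intro {p = exposed M} (only i ei (∖-≢ {p = exposed N} {x} e)) (covered≢ cu ei)) (covered≢ cv ei)
        where
        ei : exposed N i ≡ true
        ei = ∖-member {p = exposed N} {x} e

    record ExposedWalk : Set where
      constructor exposedWalk
      field
        {source target} : Fin n
        matching : Matching W
        maximum : Maximum matching
        source-exposed : mate matching source ≡ nothing
        target-exposed : mate matching target ≡ nothing
        distinct : source ≢ target
        walk : Walk W source target

    -- Take a shortest walk u x ⋯ v between exposed vertices of a maximum matching M, and a maximum
    -- matching N avoiding x that agrees with M on as many vertices as possible. N covers u and v,
    -- or there would be a shorter walk. A vertex y ≠ x exposed by N but covered by M would let N be
    -- augmented or moved closer to M; without one, N has fewer exposed vertices than M.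
    gallai : (∀ v → W v ≡ true → DoubleNegation (Avoidable v)) → (M : Matching W) → Maximum M → ExposedSeparated M
    gallai avoidable M max eu ev u≢v p =
      no-minimal⇒empty (length ∘ ExposedWalk.walk) shortest
        (exposedWalk M max (exposed-mate M eu) (exposed-mate M ev) u≢v p)
      where
      shortest : (c : ExposedWalk) → ¬ (∀ c' → length (ExposedWalk.walk c') ≮ length (ExposedWalk.walk c))
      shortest (exposedWalk M max mu mv u≢v (nil _)) _ = u≢v refl
      shortest (exposedWalk {u} {v} M max mu mv u≢v (cons {x = x} Wu Eux q)) minimal with x Fin.≟ v
      ... | yes refl = maximum⇒exposed-independent M max mu mv Wu (start q) Eux
      ... | no x≢v with mate M x in mx
      ... | nothing = maximum⇒exposed-independent M max mu mx Wu (start q) Eux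
      ... | just _ = avoidable x Wx λ a → no-maximal⇒empty (λ (N , _) → count (agreement M N)) n
                                            (λ _ → count-≤n _) closest a
        where
        Wx : W x ≡ true
        Wx = start q
        closest : (a : Avoidable x) → ¬ (∀ b → count (agreement M (proj₁ a)) ≮ count (agreement M (proj₁ b)))
        closest (N , maxN , nx) maximal with mate N u in nu | mate N v in nv
        ... | nothing | _ = minimal (exposedWalk N maxN nu nx (E⇒≢ Eux) (cons Wu Eux (nil Wx))) (s≤s (length-pos x≢v q))
        ... | just _ | nothing = minimal (exposedWalk N maxN nx nv x≢v q) (n<1+n (length q))
        ... | just u' | just v' = ¬¬-excluded-middle cases
          where
          cases : Dec (∃ λ y → exposed N y ≡ true × covered M y ≡ true × x ≢ y) → ⊥
          cases (yes (y , ey , cy , x≢y)) with mate M y in my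
          ... | just t with mate-edge M y t my
          ... | Wy , Wt , Eyt , _ with mate N t in nt
          ... | nothing = maximum⇒exposed-independent N maxN (exposed-mate N ey) nt Wy Wt Eyt
          ... | just z = maximal (N' , maxN' , nx') (agreement-< M my)
            where
            open Swap N (exposed-mate N ey) nt Wy Eyt
            maxN' : Maximum N'
            maxN' N'' = subst (size N'' ≤_) size-≡ (maxN N'')
            nx' : mate N' x ≡ nothing
            nx' = trans (mate'-other (≢-sym x≢y) (≢-sym (exposed≢matched N nx nt)) (≢-sym (exposed≢matched N nx nz))) nx
          cases (no none) = <⇒≢ (exposed-shift M N u≢v (exposed-intro M Wu mu) (exposed-intro M (end q) mv)
                                    (cong is-just nu) (cong is-just nv) (exposed-intro N Wx nx) exposed-in-M)
                                  (sym (maximum-deficiency-≡ M N max maxN))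
            where
            exposed-in-M : ∀ y → exposed N y ≡ true → x ≢ y → exposed M y ≡ true
            exposed-in-M y ey x≢y with mate M y in my
            ... | just _ = contradiction (y , ey , cong is-just my , x≢y) none
            ... | nothing = ∧-true (∧-trueˡ ey) refl

  module RemoveVertex {W : VertexSet} (M : Matching W) {v p : Fin n} (mv : mate M v ≡ just p) where

    Wv : W v ≡ true
    Wv = proj₁ (mate-edge M v p mv)
    mp : mate M p ≡ just v
    mp = proj₂ (proj₂ (proj₂ (mate-edge M v p mv)))
    v≢p : v ≢ p
    v≢p = E⇒≢ (proj₁ (proj₂ (proj₂ (mate-edge M v p mv))))

    mate' : Fin n → Maybe (Fin n)
    mate' = (mate M [ p ≔ nothing ]) [ v ≔ nothing ]

    mate'-other : ∀ {u} → v ≢ u → p ≢ u → mate' u ≡ mate M u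
    mate'-other v≢u p≢u = trans (≔-other _ v≢u) (≔-other _ p≢u)

    edge : ∀ u w → mate' u ≡ just w → (W ∖ v) u ≡ true × (W ∖ v) w ≡ true × E u w ≡ true × mate' w ≡ just u
    edge u w e with v Fin.≟ u | p Fin.≟ u
    ... | yes refl | _ with () ← trans (sym e) (≔-same _ v)
    ... | no _ | yes refl with () ← trans (sym e) (trans (≔-other _ v≢p) (≔-same _ p))
    ... | no v≢u | no p≢u with mate-edge M u w (trans (sym (mate'-other v≢u p≢u)) e)
    ... | Wu , Ww , Euw , mw = ∧-true Wu refl , ∧-true Ww (not-false (≢⇒≡ᵇ-false v≢w)) ,
                               Euw , trans (mate'-other v≢w p≢w) mw
      where
      v≢w : v ≢ w
      v≢w refl = p≢u (just-injective (trans (sym mv) mw))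
      p≢w : p ≢ w
      p≢w refl = v≢u (just-injective (trans (sym mp) mw))

    M' : Matching (W ∖ v)
    M' = record { mate = mate' ; mate-edge = edge }

    size-≡ : size M ≡ 2 + size M'
    size-≡ = trans (count-remove-pair (covered M) v≢p (cong is-just mv) (cong is-just mp)) (cong (2 +_) (count-cong same))
      where
      same : ∀ i → ((covered M ∖ v) ∖ p) i ≡ covered M' i
      same i with v Fin.≟ i | p Fin.≟ i
      ... | yes refl | p≟v = trans (cong (_∧ not (does p≟v)) (∧-zeroʳ (covered M v))) (cong is-just (sym (≔-same _ v)))
      ... | no _ | yes refl = trans (∧-zeroʳ _) (cong is-just (sym (trans (≔-other _ v≢p) (≔-same _ p))))
      ... | no v≢i | no p≢i = trans (∧-identityʳ _) (trans (∧-identityʳ _) (cong is-just (sym (mate'-other v≢i p≢i))))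

    deficiency-suc : deficiency M' ≡ suc (deficiency M)
    deficiency-suc = +-cancelˡ-≡ (size M') _ _ (begin
      size M' + deficiency M'              ≡⟨ count≡size+deficiency M' ⟨
      count (W ∖ v)                        ≡⟨ suc-injective (begin
        suc (count (W ∖ v))                  ≡⟨ count-remove-true W Wv ⟨
        count W                              ≡⟨ count≡size+deficiency M ⟩
        size M + deficiency M                ≡⟨ cong (_+ deficiency M) size-≡ ⟩
        suc (suc (size M' + deficiency M))   ∎) ⟩
      suc (size M' + deficiency M)         ≡⟨ +-suc (size M') (deficiency M) ⟨
      size M' + suc (deficiency M)         ∎)
      where open ≡-Reasoning

    M'-maximum : Maximum M → (∀ N → Maximum N → covered N v ≡ true) → Maximum M'
    M'-maximum maxM always N with size N ≤? size M'
    ... | yes N≤M' = N≤M'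
    ... | no N≰M' = contradiction (trans (sym (always N↑ N↑-maximum)) v-uncovered) λ ()
      where
      N↑ : Matching W
      N↑ = restrict (λ u → ∧-trueˡ) N
      N≡M : size N ≡ size M
      N≡M = trans (even-squeeze (size-even M') (size-even N) (≰⇒> N≰M') (subst (size N ≤_) size-≡ (maxM N↑)))
                  (sym size-≡)
      N↑-maximum : Maximum N↑
      N↑-maximum N' = subst (size N' ≤_) (sym N≡M) (maxM N')
      v-uncovered : covered N↑ v ≡ false
      v-uncovered with mate N v in nv
      ... | nothing = refl
      ... | just w = contradiction refl (∖-≢ {p = W} {v} (proj₁ (mate-edge N v w nv)))

  -- The core is what is left after repeatedly deleting a vertex covered by every maximum matching;
  -- each deletion adds one exposed vertex.
  record Reduction (W : VertexSet) (M : Matching W) : Set where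
    field
      core : VertexSet
      core⊆W : core ⊆ W
      matching : Matching core
      maximum : Maximum matching
      deficiency-≡ : deficiency matching + count core ≡ deficiency M + count W
      separated : ExposedSeparated matching

  reduction : ∀ k (W : VertexSet) → count W ≤ k → (M : Matching W) → Maximum M → DoubleNegation (Reduction W M)
  reduction k W bound M maxM goal =
    ¬¬-excluded-middle cases
    where
    cases : Dec (∃ λ v → W v ≡ true × (∀ N → Maximum N → covered N v ≡ true)) → ⊥
    cases (no none) = goal record
      { core = W ; core⊆W = λ _ Wu → Wu ; matching = M ; maximum = maxM ; deficiency-≡ = refl
      ; separated = gallai avoidable M maxM }
      where
      avoidable : ∀ v → W v ≡ true → DoubleNegation (Avoidable v)
      avoidable v Wv unavoidable = none (v , Wv , covers)
        where
        covers : ∀ N → Maximum N → covered N v ≡ true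
        covers N maxN with mate N v in nv
        ... | just _ = refl
        ... | nothing = contradiction (N , maxN , nv) unavoidable
    cases (yes (v , Wv , always)) with mate M v in mv
    ... | nothing with () ← trans (sym (always M maxM)) (cong is-just mv)
    ... | just p = shrink k bound
      where
      open RemoveVertex M mv using (M'; M'-maximum; deficiency-suc)
      W≡1+ : count W ≡ suc (count (W ∖ v))
      W≡1+ = count-remove-true W Wv
      lift : Reduction (W ∖ v) M' → Reduction W M
      lift r = record
        { core = core ; core⊆W = λ u c → ∧-trueˡ (core⊆W u c) ; matching = matching ; maximum = maximum
        ; deficiency-≡ = begin
            deficiency matching + count core     ≡⟨ Reduction.deficiency-≡ r ⟩
            deficiency M' + count (W ∖ v)        ≡⟨ cong (_+ count (W ∖ v)) deficiency-suc ⟩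
            suc (deficiency M) + count (W ∖ v)   ≡⟨ +-suc (deficiency M) (count (W ∖ v)) ⟨
            deficiency M + suc (count (W ∖ v))   ≡⟨ cong (deficiency M +_) W≡1+ ⟨
            deficiency M + count W               ∎
        ; separated = separated }
        where
        open Reduction r
        open ≡-Reasoning
      shrink : ∀ k → count W ≤ k → ⊥
      shrink zero bound = contradiction (subst (_≤ 0) W≡1+ bound) λ ()
      shrink (suc k) bound = reduction k (W ∖ v) (≤-pred (subst (_≤ suc k) W≡1+ bound)) M' (M'-maximum maxM always) (goal ∘ lift)

  edgesBetween : VertexSet → VertexSet → ℕ
  edgesBetween A B = sum (λ a → toℕ (A a) * count (λ b → E a b ∧ B b))

  edgesBetween-comm : ∀ A B → edgesBetween A B ≡ edgesBetween B A
  edgesBetween-comm A B = begin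
    sum (λ a → toℕ (A a) * count (λ b → E a b ∧ B b))
      ≡⟨ sum-cong-≗ (λ a → *-distribˡ-sum (toℕ (A a)) (λ b → toℕ (E a b ∧ B b))) ⟩
    sum (λ a → sum (λ b → toℕ (A a) * toℕ (E a b ∧ B b)))
      ≡⟨ ∑-comm (λ a b → toℕ (A a) * toℕ (E a b ∧ B b)) ⟩
    sum (λ b → sum (λ a → toℕ (A a) * toℕ (E a b ∧ B b)))
      ≡⟨ sum-cong-≗ (λ b → sum-cong-≗ (λ a → swap a b)) ⟩
    sum (λ b → sum (λ a → toℕ (B b) * toℕ (E b a ∧ A a)))
      ≡⟨ sum-cong-≗ (λ b → *-distribˡ-sum (toℕ (B b)) (λ a → toℕ (E b a ∧ A a))) ⟨
    sum (λ b → toℕ (B b) * count (λ a → E b a ∧ A a)) ∎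
    where
    open ≡-Reasoning
    swap : ∀ a b → toℕ (A a) * toℕ (E a b ∧ B b) ≡ toℕ (B b) * toℕ (E b a ∧ A a)
    swap a b rewrite E-sym a b with A a | B b | E b a
    ... | true  | true  | true  = refl
    ... | true  | true  | false = refl
    ... | true  | false | true  = refl
    ... | true  | false | false = refl
    ... | false | true  | true  = refl
    ... | false | true  | false = refl
    ... | false | false | _     = refl

  PerfectMatching : VertexSet → Set
  PerfectMatching V = Σ (Fin n → Fin n) λ f → ∀ u → V u ≡ true → V (f u) ≡ true × E u (f u) ≡ true × f (f u) ≡ u

  perfect-partner : ∀ {V} (M : Matching V) → deficiency M ≡ 0 → PerfectMatching V
  perfect-partner {V} M no-exposed = partner M , matched
    where
    matched : ∀ u → V u ≡ true → V (partner M u) ≡ true × E u (partner M u) ≡ true × partner M (partner M u) ≡ u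
    matched u Vu with mate M u in mu
    ... | nothing with () ← trans (sym (exposed-intro M Vu mu)) (count≡0⇒false (exposed M) no-exposed u)
    ... | just w with mate-edge M u w mu
    ... | _ , Vw , Euw , mw = Vw , Euw , partner-mate M mw

  perfect-extend : ∀ {V v w} → V v ≡ true → V w ≡ true → E v w ≡ true → PerfectMatching ((V ∖ v) ∖ w) → PerfectMatching V
  perfect-extend {V} {v} {w} Vv Vw Evw (f , pm) = f' , pm'
    where
    v≢w : v ≢ w
    v≢w = E⇒≢ Evw
    f' : Fin n → Fin n
    f' = (f [ w ≔ v ]) [ v ≔ w ]
    f'-v : f' v ≡ w
    f'-v = ≔-same _ v
    f'-w : f' w ≡ v
    f'-w = trans (≔-other _ v≢w) (≔-same _ w)
    f'-other : ∀ {u} → v ≢ u → w ≢ u → f' u ≡ f u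
    f'-other v≢u w≢u = trans (≔-other _ v≢u) (≔-other _ w≢u)
    pm' : ∀ u → V u ≡ true → V (f' u) ≡ true × E u (f' u) ≡ true × f' (f' u) ≡ u
    pm' u Vu with v Fin.≟ u | w Fin.≟ u
    ... | yes refl | _ rewrite f'-v = Vw , Evw , f'-w
    ... | no _ | yes refl rewrite f'-w = Vv , trans (E-sym w v) Evw , f'-v
    ... | no v≢u | no w≢u with pm u (∖-intro {p = V ∖ v} (∖-intro {p = V} Vu v≢u) w≢u)
    ... | V'fu , Eufu , ffu rewrite f'-other v≢u w≢u =
      ∖-member {p = V} {v} (∖-member {p = V ∖ v} {w} V'fu) , Eufu ,
      trans (f'-other (∖-≢ {p = V} {v} (∖-member {p = V ∖ v} {w} V'fu)) (∖-≢ {p = V ∖ v} {w} V'fu)) ffu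

  perfect-restrict : ∀ {V v} → V v ≡ true → ((f , _) : PerfectMatching V) → PerfectMatching ((V ∖ v) ∖ f v)
  perfect-restrict {V} {v} Vv (f , pm) = f , pm'
    where
    pm' : ∀ u → ((V ∖ v) ∖ f v) u ≡ true → ((V ∖ v) ∖ f v) (f u) ≡ true × E u (f u) ≡ true × f (f u) ≡ u
    pm' u e with pm u (∖-member {p = V} {v} (∖-member {p = V ∖ v} {f v} e))
    ... | Vfu , Eufu , ffu = ∖-intro {p = V ∖ v} (∖-intro {p = V} Vfu v≢fu) fv≢fu , Eufu , ffu
      where
      v≢u : v ≢ u
      v≢u = ∖-≢ {p = V} {v} (∖-member {p = V ∖ v} {f v} e)
      fv≢u : f v ≢ u
      fv≢u = ∖-≢ {p = V ∖ v} {f v} e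
      v≢fu : v ≢ f u
      v≢fu v≡fu = fv≢u (trans (cong f v≡fu) ffu)
      fv≢fu : f v ≢ f u
      fv≢fu fv≡fu = v≢u (trans (sym (proj₂ (proj₂ (pm v Vv)))) (trans (cong f fv≡fu) ffu))

  -- Decidability turns the double-negated existence proof below into an actual matching.
  perfectMatching? : ∀ k (V : VertexSet) → count V ≤ k → Dec (PerfectMatching V)
  perfectMatching? k V bound with count V ≟ 0
  ... | yes V≡0 = yes ((λ u → u) , λ u Vu → contradiction (trans (sym Vu) (count≡0⇒false V V≡0 u)) λ ())
  ... | no V≢0 with count-pos V (n≢0⇒n>0 V≢0) | k
  ... | v , Vv | zero = contradiction (n≤0⇒n≡0 bound) V≢0
  ... | v , Vv | suc k with any? partnerFor?
    where
    PartnerFor : Fin n → Set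
    PartnerFor w = (V w ∧ E v w) ≡ true × PerfectMatching ((V ∖ v) ∖ w)
    partnerFor? : ∀ w → Dec (PartnerFor w)
    partnerFor? w with V w ∧ E v w in VwEvw
    ... | false = no λ p → contradiction (proj₁ p) λ ()
    ... | true with perfectMatching? k ((V ∖ v) ∖ w) bound'
      where
      bound' : count ((V ∖ v) ∖ w) ≤ k
      bound' = ≤-pred (≤-trans (n≤1+n _) (subst (_≤ suc k) (count-remove-pair V (E⇒≢ (∧-trueʳ VwEvw)) Vv (∧-trueˡ VwEvw)) bound))
    ... | yes pm = yes (refl , pm)
    ... | no ¬pm = no (¬pm ∘ proj₂)
  ... | yes (w , VwEvw , pm) = yes (perfect-extend Vv (∧-trueˡ VwEvw) (∧-trueʳ VwEvw) pm)
  ... | no none = no λ pm → none (proj₁ pm v , ∧-true (proj₁ (proj₂ pm v Vv)) (proj₁ (proj₂ (proj₂ pm v Vv))) , perfect-restrict Vv pm)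

  module OddRegular (V : VertexSet) (d : ℕ)
    (E⊆V : ∀ u w → E u w ≡ true → V w ≡ true)
    (regular : ∀ v → V v ≡ true → count (E v) ≡ d)
    (d-odd : ¬ Even d) (order-bound : count V ≤ 3 * d + 6) where

    d-pos : 1 ≤ d
    d-pos = n≢0⇒n>0 λ d≡0 → d-odd (subst Even (sym d≡0) even-0)

    module Components (W' : VertexSet) (W'⊆V : W' ⊆ V) (M' : Matching W') (separated : ExposedSeparated M')
      (C : Fin n → VertexSet) (C⇒walk : ∀ {w y} → C w y ≡ true → Walk W' w y)
      (walk⇒C : ∀ {w y} → Walk W' w y → C w y ≡ true) where

      S U : VertexSet
      S v = V v ∧ not (W' v)
      U = exposed M'

      C⊆W' : ∀ {w y} → C w y ≡ true → W' y ≡ true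
      C⊆W' = end ∘ C⇒walk

      C-closed : ∀ {w y z} → C w y ≡ true → W' z ≡ true → E y z ≡ true → C w z ≡ true
      C-closed Cwy W'z Eyz = walk⇒C (snoc (C⇒walk Cwy) W'z Eyz)

      C-disjoint : ∀ w w' y → U w ≡ true → U w' ≡ true → C w y ≡ true → C w' y ≡ true → w ≡ w'
      C-disjoint w w' y Uw Uw' Cwy Cw'y with w Fin.≟ w'
      ... | yes w≡w' = w≡w'
      ... | no w≢w' = contradiction (C⇒walk Cwy ++ reverse (C⇒walk Cw'y)) (separated Uw Uw' w≢w')

      C-count : ∀ {w} → U w ≡ true → count (C w) ≡ suc (count (C w ∖ w))
      C-count {w} Uw = count-remove-true (C w) (walk⇒C (nil (∧-trueˡ Uw)))

      C-odd : ∀ {w} → U w ≡ true → ¬ Even (count (C w))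
      C-odd {w} Uw even-C = ¬even-1 (∣m+n∣m⇒∣n (subst Even (trans (C-count Uw) (+-comm 1 _)) even-C)
                                       (even-count-involution (partner M') (C w ∖ w) involution))
        where
        involution : FixedPointFreeInvolutionOn (partner M') (C w ∖ w)
        involution y e with mate M' y in my
        ... | nothing = contradiction (C⇒walk Cwy) (separated Uw (exposed-intro M' (C⊆W' Cwy) my) (∖-≢ {p = C w} {w} e))
          where
          Cwy : C w y ≡ true
          Cwy = ∖-member {p = C w} {w} e
        ... | just p with mate-edge M' y p my
        ... | _ , W'p , Eyp , mp = ∖-intro {p = C w} (C-closed (∖-member {p = C w} {w} e) W'p Eyp) w≢p ,
                                   partner-mate M' mp , λ p≡y → E⇒≢ Eyp (sym p≡y)
          where
          w≢p : w ≢ p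
          w≢p = exposed≢matched M' (exposed-mate M' Uw) mp

      inside outside : Fin n → Fin n → ℕ
      inside w v = count (λ z → E v z ∧ C w z)
      outside w v = count (λ z → E v z ∧ not (C w z))

      degree-split : ∀ {w v} → C w v ≡ true → inside w v + outside w v ≡ d
      degree-split {w} {v} Cwv = trans (sym (count-split (E v) (C w))) (regular v (W'⊆V v (C⊆W' Cwv)))

      leaves-into-S : ∀ {w v z} → C w v ≡ true → (E v z ∧ not (C w z)) ≡ true → (E v z ∧ S z) ≡ true
      leaves-into-S {w} {v} {z} Cwv e with W' z in W'z
      ... | true with () ← trans (sym (C-closed Cwv W'z (∧-trueˡ e))) (not-true (∧-trueʳ {E v z} e))
      ... | false = ∧-true (∧-trueˡ {E v z} e) (∧-true (E⊆V v z (∧-trueˡ {E v z} e)) refl)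

      boundary : Fin n → ℕ
      boundary w = edgesBetween (C w) S

      internal external : Fin n → ℕ
      internal w = sum (λ v → toℕ (C w v) * inside w v)
      external w = sum (λ v → toℕ (C w v) * outside w v)

      external≤boundary : ∀ w → external w ≤ boundary w
      external≤boundary w = sum-mono-≤ pt
        where
        pt : ∀ v → toℕ (C w v) * outside w v ≤ toℕ (C w v) * count (λ z → E v z ∧ S z)
        pt v with C w v in Cwv
        ... | true = *-monoʳ-≤ 1 (count-≤ (λ z → leaves-into-S {w} {v} {z} Cwv))
        ... | false = z≤n

      internal+external : ∀ w → internal w + external w ≡ count (C w) * d
      internal+external w = begin
        internal w + external w
          ≡⟨ ∑-distrib-+ (λ v → toℕ (C w v) * inside w v) (λ v → toℕ (C w v) * outside w v) ⟨
        sum (λ v → toℕ (C w v) * inside w v + toℕ (C w v) * outside w v)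
          ≡⟨ sum-cong-≗ pt ⟩
        sum (λ v → toℕ (C w v) * d)
          ≡⟨ *-distribʳ-sum d (λ v → toℕ (C w v)) ⟨
        count (C w) * d ∎
        where
        open ≡-Reasoning
        pt : ∀ v → toℕ (C w v) * inside w v + toℕ (C w v) * outside w v ≡ toℕ (C w v) * d
        pt v with C w v in Cwv
        ... | true = trans (sym (*-distribˡ-+ 1 (inside w v) (outside w v))) (cong (1 *_) (degree-split Cwv))
        ... | false = refl

      internal-even : ∀ w → Even (internal w)
      internal-even w = subst Even (sum-cong-≗ λ v → sym (toℕ*count (C w v) (λ z → E v z ∧ C w z)))
                          (handshake R R-sym R-irrefl)
        where
        R : Fin n → Fin n → Bool
        R v z = C w v ∧ (E v z ∧ C w z)
        R-sym : ∀ v z → R v z ≡ R z v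
        R-sym v z rewrite E-sym v z with C w v | C w z
        ... | true  | true  = refl
        ... | true  | false = ∧-zeroʳ _
        ... | false | true  = sym (∧-zeroʳ _)
        ... | false | false = refl
        R-irrefl : ∀ v → R v v ≡ false
        R-irrefl v rewrite E-irrefl v = ∧-zeroʳ (C w v)

      -- By parity: internal w is even, while internal w + external w = |C w| d is odd.
      boundary-pos : ∀ {w} → U w ≡ true → 1 ≤ boundary w
      boundary-pos {w} Uw with external w in ext
      ... | suc _ = ≤-trans (s≤s z≤n) (≤-trans (≤-reflexive (sym ext)) (external≤boundary w))
      ... | zero = contradiction (subst Even (trans (sym (+-identityʳ _)) (trans (cong (internal w +_) (sym ext)) (internal+external w)))
                                   (internal-even w))
                                 (odd*odd (count (C w)) d (C-odd Uw) d-odd)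

      -- Each vertex of C w has at least d + 1 - |C w| neighbours outside C w, all of them in S.
      boundary-small : ∀ {w} → U w ≡ true → count (C w) ≤ d → d ≤ boundary w
      boundary-small {w} Uw C≤d = begin
        d                                          ≤⟨ d≤c*[1+d∸c] (≤-trans (s≤s z≤n) (≤-reflexive (sym (C-count Uw)))) C≤d ⟩
        count (C w) * (suc d ∸ count (C w))        ≡⟨ *-distribʳ-sum (suc d ∸ count (C w)) (λ v → toℕ (C w v)) ⟩
        sum (λ v → toℕ (C w v) * (suc d ∸ count (C w)))  ≤⟨ sum-mono-≤ pt ⟩
        boundary w                                 ∎
        where
        open ≤-Reasoning
        pt : ∀ v → toℕ (C w v) * (suc d ∸ count (C w)) ≤ toℕ (C w v) * count (λ z → E v z ∧ S z)
        pt v with C w v in Cwv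
        ... | false = z≤n
        ... | true = *-monoʳ-≤ 1 (begin
          suc d ∸ count (C w)                     ≤⟨ ∸-monoʳ-≤ (suc d) inside<C ⟩
          d ∸ inside w v                          ≡⟨ cong (_∸ inside w v) (degree-split Cwv) ⟨
          inside w v + outside w v ∸ inside w v   ≡⟨ m+n∸m≡n (inside w v) (outside w v) ⟩
          outside w v                             ≤⟨ count-≤ (λ z → leaves-into-S {w} {v} {z} Cwv) ⟩
          count (λ z → E v z ∧ S z)               ∎)
          where
          inside<C : inside w v < count (C w)
          inside<C = count-< v (λ z → ∧-trueʳ) (cong (_∧ C w v) (E-irrefl v)) Cwv

      component-large : ∀ {w} → U w ≡ true → ¬ count (C w) ≤ d → 2 + d ≤ count (C w)
      component-large {w} Uw C≰d with m≤n⇒m<n∨m≡n (≰⇒> C≰d) | even⊎even-suc d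
      ... | inj₁ 2+d≤C | _ = 2+d≤C
      ... | inj₂ _ | inj₁ even-d = contradiction even-d d-odd
      ... | inj₂ 1+d≡C | inj₂ even-1+d = contradiction (subst Even 1+d≡C even-1+d) (C-odd Uw)

      boundary-total : sum (λ w → toℕ (U w) * boundary w) ≤ count S * d
      boundary-total = begin
        sum (λ w → toℕ (U w) * boundary w)
          ≡⟨ sum-cong-≗ (λ w → cong (toℕ (U w) *_) (edgesBetween-comm (C w) S)) ⟩
        sum (λ w → toℕ (U w) * sum (λ z → toℕ (S z) * count (λ v → E z v ∧ C w v)))
          ≡⟨ sum-cong-≗ (λ w → *-distribˡ-sum (toℕ (U w)) (λ z → toℕ (S z) * count (λ v → E z v ∧ C w v))) ⟩
        sum (λ w → sum (λ z → toℕ (U w) * (toℕ (S z) * count (λ v → E z v ∧ C w v))))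
          ≡⟨ ∑-comm (λ w z → toℕ (U w) * (toℕ (S z) * count (λ v → E z v ∧ C w v))) ⟩
        sum (λ z → sum (λ w → toℕ (U w) * (toℕ (S z) * count (λ v → E z v ∧ C w v))))
          ≡⟨ sum-cong-≗ (λ z → sum-cong-≗ (λ w → cong (toℕ (U w) *_)
               (trans (toℕ*count (S z) (λ v → E z v ∧ C w v)) (count-cong (λ v → sym (∧-assoc (S z) (E z v) (C w v))))))) ⟩
        sum (λ z → sum (λ w → toℕ (U w) * count (λ v → (S z ∧ E z v) ∧ C w v)))
          ≤⟨ sum-mono-≤ (λ z → sum-disjoint-≤ U (λ v → S z ∧ E z v) C C-disjoint) ⟩
        sum (λ z → count (λ v → S z ∧ E z v))
          ≡⟨ sum-cong-≗ degree-of-S ⟩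
        sum (λ z → toℕ (S z) * d)
          ≡⟨ *-distribʳ-sum d (λ z → toℕ (S z)) ⟨
        count S * d ∎
        where
        open ≤-Reasoning
        degree-of-S : ∀ z → count (λ v → S z ∧ E z v) ≡ toℕ (S z) * d
        degree-of-S z with S z in Sz
        ... | true = trans (regular z (∧-trueˡ Sz)) (sym (+-identityʳ d))
        ... | false = sum-replicate-zero n

      small large : VertexSet
      small w = U w ∧ does (count (C w) ≤? d)
      large w = U w ∧ not (does (count (C w) ≤? d))

      boundary-lower : count small * d + count large ≤ sum (λ w → toℕ (U w) * boundary w)
      boundary-lower = begin
        count small * d + count large
          ≡⟨ cong (count small * d +_) (*-identityʳ (count large)) ⟨
        count small * d + count large * 1
          ≤⟨ +-mono-≤ (count*≤sum small boundary λ w e → boundary-small (∧-trueˡ e) (does-true⇒ (_ ≤? d) (∧-trueʳ e)))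
                      (count*≤sum large boundary λ w e → boundary-pos (∧-trueˡ e)) ⟩
        sum (λ w → toℕ (small w) * boundary w) + sum (λ w → toℕ (large w) * boundary w)
          ≡⟨ sum-split U (λ w → does (count (C w) ≤? d)) boundary ⟨
        sum (λ w → toℕ (U w) * boundary w) ∎
        where open ≤-Reasoning

      large-total : count large * (2 + d) ≤ count W'
      large-total = begin
        count large * (2 + d)
          ≤⟨ count*≤sum large (count ∘ C)
               (λ w e → component-large (∧-trueˡ e) (does-false⇒ (_ ≤? d) (not-true (∧-trueʳ e)))) ⟩
        sum (λ w → toℕ (large w) * count (C w))
          ≡⟨ sum-cong-≗ (λ w → cong (toℕ (large w) *_) (count-cong (λ v → within-W' w v))) ⟩
        sum (λ w → toℕ (large w) * count (λ v → W' v ∧ C w v))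
          ≤⟨ sum-disjoint-≤ large W' C (λ w w' y e e' → C-disjoint w w' y (∧-trueˡ e) (∧-trueˡ e')) ⟩
        count W' ∎
        where
        open ≤-Reasoning
        within-W' : ∀ w v → C w v ≡ (W' v ∧ C w v)
        within-W' w v with C w v in Cwv
        ... | true = sym (∧-true (C⊆W' Cwv) refl)
        ... | false = sym (∧-zeroʳ (W' v))

      too-many-odd-components : count W' + count S ≤ 3 * d + 6 → count S + 2 ≤ count U → ⊥
      too-many-odd-components W'+S≤ S+2≤U =
        component-bounds-absurd (count small) (count large) (count S) d (count W') d-pos
          (≤-trans boundary-lower boundary-total) large-total W'+S≤
          (subst (count S + 2 ≤_) (count-split U (λ w → does (count (C w) ≤? d))) S+2≤U)

    V-even : Even (count V)
    V-even with euclidsLemma (count V) d prime[2] (subst Even degree-sum (handshake E E-sym E-irrefl))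
      where
      degree-sum : sum (λ v → count (E v)) ≡ count V * d
      degree-sum = trans (sum-cong-≗ degree-on-V) (sym (*-distribʳ-sum d (λ v → toℕ (V v))))
        where
        degree-on-V : ∀ v → count (E v) ≡ toℕ (V v) * d
        degree-on-V v with V v in Vv
        ... | true = trans (regular v Vv) (sym (+-identityʳ d))
        ... | false = count-false (E v) isolated
          where
          isolated : ∀ w → E v w ≡ false
          isolated w with E v w in Evw
          ... | false = refl
          ... | true with () ← trans (sym (E⊆V w v (trans (E-sym w v) Evw))) Vv
    ... | inj₁ even-V = even-V
    ... | inj₂ even-d = contradiction even-d d-odd

    maximum-not-deficient : (M : Matching V) → Maximum M → ¬ 0 < deficiency M
    maximum-not-deficient M maxM deficient = reduction n V (count-≤n V) M maxM λ r →
      ¬¬-∀-Fin (λ w → ¬¬-∀-Fin (λ y → ¬¬-excluded-middle)) (separate r)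
      where
      2≤deficiency : 2 ≤ deficiency M
      2≤deficiency with deficiency M | ∣m+n∣m⇒∣n (subst Even (count≡size+deficiency M) V-even) (size-even M)
      ... | 1 | even-1 = contradiction even-1 ¬even-1
      ... | suc (suc _) | _ = s≤s (s≤s z≤n)
      separate : (r : Reduction V M) → ¬ (∀ w y → Dec (Walk (Reduction.core r) w y))
      separate r walk? = too-many-odd-components (subst (_≤ 3 * d + 6) V≡W'+S order-bound) S+2≤U
        where
        open Reduction r
        open Components core core⊆W matching separated (λ w y → does (walk? w y))
                        (does-true⇒ (walk? _ _)) (dec-true (walk? _ _))
        V≡W'+S : count V ≡ count core + count S
        V≡W'+S = trans (count-split V core) (cong (_+ count S) (count-cong in-core))
          where
          in-core : ∀ i → (V i ∧ core i) ≡ core i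
          in-core i with core i in ci
          ... | true = ∧-true (core⊆W i ci) refl
          ... | false = ∧-zeroʳ (V i)
        U≡deficiency+S : count U ≡ deficiency M + count S
        U≡deficiency+S = +-cancelʳ-≡ (count core) (count U) (deficiency M + count S) (begin
          count U + count core                ≡⟨ deficiency-≡ ⟩
          deficiency M + count V              ≡⟨ cong (deficiency M +_) V≡W'+S ⟩
          deficiency M + (count core + count S)  ≡⟨ x+[y+z]≡x+z+y (deficiency M) (count core) (count S) ⟩
          deficiency M + count S + count core ∎)
          where
          open ≡-Reasoning
          x+[y+z]≡x+z+y : ∀ x y z → x + (y + z) ≡ x + z + y
          x+[y+z]≡x+z+y = solve-∀
        S+2≤U : count S + 2 ≤ count U
        S+2≤U = subst (count S + 2 ≤_) (trans (+-comm (count S) (deficiency M)) (sym U≡deficiency+S))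
                  (+-monoʳ-≤ (count S) 2≤deficiency)

    perfect-matching : PerfectMatching V
    perfect-matching with perfectMatching? n V (count-≤n V)
    ... | yes pm = pm
    ... | no ¬pm = ⊥-elim (no-maximal⇒empty size n (count-≤n ∘ covered) maximum-is-perfect empty)
      where
      maximum-is-perfect : (M : Matching V) → ¬ (∀ N → size M ≮ size N)
      maximum-is-perfect M maximal with deficiency M ≟ 0
      ... | yes perfect = ¬pm (perfect-partner M perfect)
      ... | no deficient = maximum-not-deficient M (λ N → ≮⇒≥ (maximal N)) (n≢0⇒n>0 deficient)

-- Extending G by a perfect matching of the complement on each side

module _ {n : ℕ} (G : Graph n) where

  NonEdgePairingOn : (Fin n → Bool) → (Fin n → Fin n) → Set
  NonEdgePairingOn P f = ∀ u → P u ≡ true → P (f u) ≡ true × adj G u (f u) ≡ false × f u ≢ u × f (f u) ≡ u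

  NonEdgePairing : (Fin n → Fin n) → Set
  NonEdgePairing f = ∀ u → adj G u (f u) ≡ false × f u ≢ u × f (f u) ≡ u

module SideComplement {n r : ℕ} (G : Graph n) (regular : Regular r G) (P : Fin n → Bool)
  (P-complete : ∀ u w → P u ≡ true → P w ≡ false → adj G u w ≡ true)
  {o : Fin n} (Po : P o ≡ false) {v₀ : Fin n} (Pv₀ : P v₀ ≡ true)
  (n-even : Even n) (r-even : Even r) (hyp : (n ≥ 64 × 4 * r < 3 * n) ⊎ (n < 64 × r + 16 < n)) where

  E : Fin n → Fin n → Bool
  E u w = P u ∧ (P w ∧ (not (adj G u w) ∧ not (u ≡ᵇ w)))

  E-sym : ∀ u w → E u w ≡ E w u
  E-sym u w rewrite Graph.sym G u w | ≡ᵇ-sym u w with P u | P w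
  ... | true  | true  = refl
  ... | true  | false = refl
  ... | false | true  = refl
  ... | false | false = refl

  E-irrefl : ∀ u → E u u ≡ false
  E-irrefl u rewrite ≡ᵇ-refl u with P u | adj G u u
  ... | true  | true  = refl
  ... | true  | false = refl
  ... | false | _     = refl

  degree-adj : ∀ v → count (adj G v) ≡ r
  degree-adj v = trans (sym (countTrue≡count (adj G v))) (regular v)

  degree-E : ∀ {v} → P v ≡ true → count (E v) + suc r ≡ n
  degree-E {v} Pv = begin
    count (E v) + suc r
      ≡⟨ cong (count (E v) +_) (trans (+-comm 1 r) (sym (cong₂ _+_ (degree-adj v) (count-singleton v)))) ⟩
    count (E v) + (count (adj G v) + count (v ≡ᵇ_))
      ≡⟨ count-exactly-one (E v) (adj G v) (v ≡ᵇ_) one ⟩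
    n ∎
    where
    open ≡-Reasoning
    one : ∀ w → toℕ (E v w) + (toℕ (adj G v w) + toℕ (v ≡ᵇ w)) ≡ 1
    one w with v Fin.≟ w
    ... | yes refl rewrite Pv | Graph.irrefl G v = refl
    ... | no v≢w with P w in Pw
    ... | false rewrite Pv | P-complete v w Pv Pw = refl
    ... | true rewrite Pv with adj G v w
    ... | true = refl
    ... | false = refl

  -- Truncated subtraction; n ≡ d + suc r is recovered below from the degrees at v₀.
  d : ℕ
  d = n ∸ suc r

  E-regular : ∀ v → P v ≡ true → count (E v) ≡ d
  E-regular v Pv = sym (trans (cong (_∸ suc r) (sym (degree-E Pv))) (m+n∸n≡m (count (E v)) (suc r)))

  n≡d+1+r : n ≡ d + suc r
  n≡d+1+r = trans (sym (degree-E Pv₀)) (cong (_+ suc r) (E-regular v₀ Pv₀))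

  d-odd : ¬ Even d
  d-odd even-d = ¬even-1 (∣m+n∣m⇒∣n (subst Even (+-comm 1 r) (∣m+n∣m⇒∣n (subst Even n≡d+1+r n-even) even-d)) r-even)

  E⊆P : ∀ u w → E u w ≡ true → P w ≡ true
  E⊆P u w e = ∧-trueˡ (∧-trueʳ {P u} e)

  P-bound : count P ≤ 3 * d + 6
  P-bound = begin
    count P          ≤⟨ count-≤ (λ w Pw → trans (Graph.sym G o w) (P-complete w o Pw Po)) ⟩
    count (adj G o)  ≡⟨ degree-adj o ⟩
    r                ≤⟨ r≤3d+6 n≡d+1+r hyp ⟩
    3 * d + 6        ∎
    where open ≤-Reasoning

  pairing : Σ (Fin n → Fin n) (NonEdgePairingOn G P)
  pairing with Matchings.OddRegular.perfect-matching E E-sym E-irrefl P d E⊆P E-regular d-odd P-bound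
  ... | f , perfect = f , λ u Pu → let Pfu , Eufu , ffu = perfect u Pu in Pfu , E⇒nonadjacent Eufu , E⇒≢ Eufu , ffu
    where
    E⇒nonadjacent : ∀ {u w} → E u w ≡ true → adj G u w ≡ false
    E⇒nonadjacent {u} {w} e = not-true (∧-trueˡ (∧-trueʳ {P w} (∧-trueʳ {P u} e)))
    E⇒≢ : ∀ {u w} → E u w ≡ true → w ≢ u
    E⇒≢ {u} {w} e w≡u = ≡ᵇ-false⇒≢ (not-true (∧-trueʳ {not (adj G u w)} (∧-trueʳ {P w} (∧-trueʳ {P u} e)))) (sym w≡u)

module AddPairing {n r : ℕ} (G : Graph n) (regular : Regular r G) (f : Fin n → Fin n)
  (f-pairing : NonEdgePairing G f) where

  adj' : Fin n → Fin n → Bool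
  adj' u w = adj G u w ∨ (f u ≡ᵇ w)

  f-≡ᵇ-sym : ∀ u w → (f u ≡ᵇ w) ≡ (f w ≡ᵇ u)
  f-≡ᵇ-sym u w with f u Fin.≟ w | f w Fin.≟ u
  ... | yes _ | yes _ = refl
  ... | no _ | no _ = refl
  ... | yes refl | no fw≢u = contradiction (proj₂ (proj₂ (f-pairing u))) fw≢u
  ... | no fu≢w | yes refl = contradiction (proj₂ (proj₂ (f-pairing w))) fu≢w

  G' : Graph n
  G' = record
    { adj = adj'
    ; sym = λ u w → cong₂ _∨_ (Graph.sym G u w) (f-≡ᵇ-sym u w)
    ; irrefl = λ u → trans (cong (_∨ (f u ≡ᵇ u)) (Graph.irrefl G u)) (≢⇒≡ᵇ-false (proj₁ (proj₂ (f-pairing u))))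
    }

  G⊆G' : SubgraphOf G G'
  G⊆G' u w e rewrite e = refl

  G'-regular : Regular (suc r) G'
  G'-regular v = begin
    countTrue (adj' v)                              ≡⟨ countTrue≡count (adj' v) ⟩
    count (adj' v)                                  ≡⟨ count-remove (adj' v) (f v) ⟩
    toℕ (adj' v (f v)) + count (adj' v ∖ f v)       ≡⟨ cong₂ _+_ (cong toℕ adj'-fv) (count-cong same) ⟩
    1 + count (adj G v ∖ f v)                       ≡⟨ cong (λ b → 1 + (toℕ b + count (adj G v ∖ f v))) (proj₁ (f-pairing v)) ⟨
    1 + (toℕ (adj G v (f v)) + count (adj G v ∖ f v)) ≡⟨ cong suc (count-remove (adj G v) (f v)) ⟨
    suc (count (adj G v))                           ≡⟨ cong suc (countTrue≡count (adj G v)) ⟨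
    suc (countTrue (adj G v))                       ≡⟨ cong suc (regular v) ⟩
    suc r                                           ∎
    where
    open ≡-Reasoning
    adj'-fv : adj' v (f v) ≡ true
    adj'-fv = trans (cong (adj G v (f v) ∨_) (≡ᵇ-refl (f v))) (∨-zeroʳ _)
    same : ∀ i → (adj' v ∖ f v) i ≡ (adj G v ∖ f v) i
    same i with f v Fin.≟ i
    ... | yes _ = trans (∧-zeroʳ _) (sym (∧-zeroʳ _))
    ... | no _ = cong (_∧ true) (∨-identityʳ _)

onSide : ∀ {n} → (Fin n → Bool) → Bool → Fin n → Bool
onSide side s u = does (side u Bool.≟ s)

glue-pairings : ∀ {n} (G : Graph n) (side : Fin n → Bool) →
                (∀ s → Σ (Fin n → Fin n) (NonEdgePairingOn G (onSide side s))) → Σ (Fin n → Fin n) (NonEdgePairing G)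
glue-pairings {n} G side pairingOn = mate , mate-pairing
  where
  mate : Fin n → Fin n
  mate u = proj₁ (pairingOn (side u)) u
  mate-pairing : NonEdgePairing G mate
  mate-pairing u with proj₂ (pairingOn (side u)) u (dec-true (side u Bool.≟ side u) refl)
  ... | same-side , nonadjacent , mate≢u , mate-mate = nonadjacent , mate≢u ,
    subst (λ s → proj₁ (pairingOn s) (mate u) ≡ u) (sym (does-true⇒ (side (mate u) Bool.≟ side u) same-side)) mate-mate

mainTheorem5 : (n r : ℕ) → 2 ∣ n → 2 ∣ r →
    ((n ≥ 64 × 4 * r < 3 * n) ⊎ (n < 64 × r + 16 < n)) →
    (G : Graph n) → Regular r G → HasSpanningCompleteBipartite G →
    ∃ λ (G' : Graph n) → SubgraphOf G G' × Regular (suc r) G'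
mainTheorem5 n r n-even r-even hyp G regular (side , (a , side-a) , (b , side-b) , complete) =
  G' , G⊆G' , G'-regular
  where
  sides-complete : ∀ s u w → onSide side s u ≡ true → onSide side s w ≡ false → adj G u w ≡ true
  sides-complete true u w on off =
    complete u w (does-true⇒ (side u Bool.≟ true) on) (¬-not (does-false⇒ (side w Bool.≟ true) off))
  sides-complete false u w on off =
    trans (Graph.sym G u w) (complete w u (¬-not (does-false⇒ (side w Bool.≟ false) off)) (does-true⇒ (side u Bool.≟ false) on))

  member : ∀ s → ∃ λ v → onSide side s v ≡ true
  member true = a , cong (λ x → does (x Bool.≟ true)) side-a
  member false = b , cong (λ x → does (x Bool.≟ false)) side-b

  outsider : ∀ s → ∃ λ o → onSide side s o ≡ false
  outsider true = b , cong (λ x → does (x Bool.≟ true)) side-b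
  outsider false = a , cong (λ x → does (x Bool.≟ false)) side-a

  pairing : Σ (Fin n → Fin n) (NonEdgePairing G)
  pairing = glue-pairings G side λ s →
    SideComplement.pairing G regular (onSide side s) (sides-complete s) (proj₂ (outsider s)) (proj₂ (member s)) n-even r-even hyp

  open AddPairing G regular (proj₁ pairing) (proj₂ pairing)
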